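{- There exist algebras $\langle A,\rightarrow,\top\rangle$ (with $\rightarrow$ a binary operation and $\top\in A$) satisfying the exchange principle $x\rightarrow(y\rightarrow z)=y\rightarrow(x\rightarrow z)$ for all $x,y,z\in A$, such that $\langle A,\rightarrow,\rightarrow,\top\rangle$ is not a Semi-BCI algebra.
   Context: A Semi-BCI (SBCI) algebra is a structure $\langle A,\twoheadrightarrow,\rightarrow,\top\rangle$ with two binary operations and $\top\in A$, where $x\ll y$ iff $x\twoheadrightarrow y=\top$ and $x\preceq y$ iff $x\rightarrow y=\top$, such that for all $x,y,z$: (S1) $x\twoheadrightarrow(y\twoheadrightarrow z)=y\twoheadrightarrow(x\twoheadrightarrow z)$; (S2) $x\rightarrow(y\rightarrow z)=y\rightarrow(x\rightarrow z)$; (S3) $x\twoheadrightarrow y\preceq(z\twoheadrightarrow x)\rightarrow(z\twoheadrightarrow y)$; (S4) $\top\twoheadrightarrow x=x$; (S5) if $x\ll y\preceq z$ then $x\ll z$; (S6) if $x\preceq y\ll z$ then $x\ll z$; (S7) if $x\preceq y$ and $y\preceq x$ then $x=y$. -}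

module Defs where

open import Relation.Binary.PropositionalEquality using (_≡_)

-- Semi-BCI algebra axioms for ⟨ A , ↠ , ⇒ , ⊤ ⟩, with
--   x ≪ y  iff  x ↠ y ≡ ⊤     and     x ≼ y  iff  x ⇒ y ≡ ⊤
record IsSBCI (A : Set) (_↠_ : A → A → A) (_⇒_ : A → A → A) (⊤ : A) : Set where
  field
    S1 : ∀ x y z → x ↠ (y ↠ z) ≡ y ↠ (x ↠ z)
    S2 : ∀ x y z → x ⇒ (y ⇒ z) ≡ y ⇒ (x ⇒ z)
    S3 : ∀ x y z → (x ↠ y) ⇒ ((z ↠ x) ⇒ (z ↠ y)) ≡ ⊤
    S4 : ∀ x → ⊤ ↠ x ≡ x
    S5 : ∀ x y z → x ↠ y ≡ ⊤ → y ⇒ z ≡ ⊤ → x ↠ z ≡ ⊤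
    S6 : ∀ x y z → x ⇒ y ≡ ⊤ → y ↠ z ≡ ⊤ → x ↠ z ≡ ⊤
    S7 : ∀ x y → x ⇒ y ≡ ⊤ → y ⇒ x ≡ ⊤ → x ≡ y

Exchange : (A : Set) → (A → A → A) → Set
Exchange A _⇒_ = ∀ x y z → x ⇒ (y ⇒ z) ≡ y ⇒ (x ⇒ z)

-- The exchange law x ⇒ (y ⇒ z) ≡ y ⇒ (x ⇒ z) only constrains how ⇒ behaves
-- under nesting, so every constant operation satisfies it trivially.  On the
-- other hand axiom (S4), ⊤ ↠ x ≡ x, says that ⊤ ↠_ is the identity map, which
-- is surjective; a constant operation whose carrier has two distinct elements
-- can never have this property.  Hence on Bool the constant operation with
-- value true, taking ⊤ = false, is an exchange algebra that is not Semi-BCI.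
module Submission where

open import Defs
open import Data.Product using (Σ; _×_; _,_)
open import Data.Bool using (Bool; true; false)
open import Relation.Nullary using (¬_)
open import Relation.Binary.PropositionalEquality using (_≢_; refl; sym)

constOp : {A : Set} → A → A → A → A
constOp c _ _ = c

constOp-exchange : {A : Set} (c : A) → Exchange A (constOp c)
constOp-exchange c _ _ _ = refl

constOp-violates-S4 : {A : Set} (c y : A) → y ≢ c →
  (_⇒_ : A → A → A) (⊤ : A) → ¬ IsSBCI A (constOp c) _⇒_ ⊤
constOp-violates-S4 c y y≢c _⇒_ ⊤ sbci = y≢c (sym (IsSBCI.S4 sbci y))

false≢true : false ≢ true
false≢true ()

proposition13 : Σ Set λ A → Σ (A → A → A) λ _⇒_ → Σ A λ ⊤ →
    Exchange A _⇒_ × ¬ IsSBCI A _⇒_ _⇒_ ⊤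
proposition13 =
  Bool , constOp true , false ,
  constOp-exchange true ,
  constOp-violates-S4 true false false≢true (constOp true) false
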